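{- Let $I$ be an instance of LBUBFL with uniform bounds having a feasible solution, let $O$ be an optimal solution of $I$, and let $S^t=(\mathcal{F}^t,\sigma^t)$ be a tri-criteria solution of $I$ as described in the context. Let $I_1$ be the instance defined in the context. Then the cost of an optimal solution of $I_1$ is at most $Cost_I(S^t)+Cost_I(O)$.
   Context: An LBUBFL instance $I$ with uniform bounds consists of a finite client set $\mathcal{C}$, a finite facility set $\mathcal{F}$, a metric $c$ on $\mathcal{C}\cup\mathcal{F}$, opening costs $f_i\ge0$, and uniform lower and upper bounds $\mathcal{L},\mathcal{U}$. A feasible solution is $(\mathcal{F}',\sigma)$ with $\mathcal{F}'\subseteq\mathcal{F}$, $\sigma:\mathcal{C}\to\mathcal{F}'$, $\mathcal{L}\le|\sigma^{ -1}(i)|\le\mathcal{U}$ for all $i\in\mathcal{F}'$; for any pair $S=(\mathcal{F}',\sigma)$ its cost is $Cost_I(S)=\sum_{i\in\mathcal{F}'}f_i+\sum_{j}c(j,\sigma(j))$. The tri-criteria solution $S^t=(\mathcal{F}^t,\sigma^t)$ satisfies $\mathcal{F}^t\subseteq\mathcal{F}$, $\sigma^t:\mathcal{C}\to\mathcal{F}^t$, and $\alpha\mathcal{L}\le|(\sigma^t)^{ -1}(i)|\le\beta\mathcal{U}$ for all $i\in\mathcal{F}^t$, with $1/2<\alpha\le1$ and $\beta=3/2$. The instance $I_1$ is the LBUBFL instance with the same facility set $\mathcal{F}$, the same bounds $\mathcal{L},\mathcal{U}$ and the same client set, in which each client $j$ is relocated to the facility $\sigma^t(j)$, i.e. the cost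 of serving $j$ from $i\in\mathcal{F}$ in $I_1$ is $c(\sigma^t(j),i)$, and with opening costs $f^1_i=0$ for $i\in\mathcal{F}^t$ and $f^1_i=f_i$ for $i\notin\mathcal{F}^t$.
   Formalization: The metric c takes rational values, and the opening costs $f_i$ and the parameter α are rational. -}

module Defs where

open import Data.Nat as ℕ using (ℕ)
open import Data.Integer using (+_)
open import Data.Rational using (ℚ; 0ℚ; ½; _+_; _*_; _/_; _≤_; _<_)
open import Data.Fin using (Fin; _≟_)
open import Data.Fin.Subset using (Subset; _∈_)
open import Data.Vec using (lookup)
open import Data.Bool using (if_then_else_)
open import Data.List using (List; foldr; map; length; filter; allFin)
open import Data.Sum using (_⊎_; inj₁; inj₂)
open import Data.Product using (Σ; _×_; _,_; ∃)
open import Relation.Binary.PropositionalEquality using (_≡_)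

sumℚ : List ℚ → ℚ
sumℚ = foldr _+_ 0ℚ

Point : ℕ → ℕ → Set
Point m n = Fin m ⊎ Fin n

client : ∀ {m n} → Fin m → Point m n
client = inj₁

facility : ∀ {m n} → Fin n → Point m n
facility = inj₂

record IsMetric {A : Set} (c : A → A → ℚ) : Set where
  field
    nonneg   : ∀ x y → 0ℚ ≤ c x y
    zero-iff : ∀ x y → c x y ≡ 0ℚ → x ≡ y
    refl0    : ∀ x → c x x ≡ 0ℚ
    symm     : ∀ x y → c x y ≡ c y x
    triangle : ∀ x y z → c x z ≤ c x y + c y z

-- An LBUBFL instance with uniform bounds, abstracted to what a solution's
-- cost and feasibility depend on: opening costs, service costs, bounds.
record Instance (m n : ℕ) : Set where
  field
    fcost : Fin n → ℚ
    scost : Fin m → Fin n → ℚ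
    L U   : ℕ
open Instance public

record Sol (m n : ℕ) : Set where
  constructor sol
  field
    opened : Subset n
    assign : Fin m → Fin n
    assign-open : ∀ j → assign j ∈ opened
open Sol public

load : ∀ {m n} → (Fin m → Fin n) → Fin n → ℕ
load {m} σ i = length (filter (λ j → σ j ≟ i) (allFin m))

Cost : ∀ {m n} → Instance m n → Sol m n → ℚ
Cost {m} {n} I S =
  sumℚ (map (λ i → if lookup (opened S) i then fcost I i else 0ℚ) (allFin n))
  + sumℚ (map (λ j → scost I j (assign S j)) (allFin m))

Feasible : ∀ {m n} → Instance m n → Sol m n → Set
Feasible I S = ∀ i → i ∈ opened S →
  (L I ℕ.≤ load (assign S) i) × (load (assign S) i ℕ.≤ U I)

Optimal : ∀ {m n} → Instance m n → Sol m n → Set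
Optimal I O = Feasible I O × (∀ S → Feasible I S → Cost I O ≤ Cost I S)

toℚ : ℕ → ℚ
toℚ k = + k / 1

β : ℚ
β = + 3 / 2

TriCriteria : ∀ {m n} → Instance m n → ℚ → Sol m n → Set
TriCriteria I α S = ∀ i → i ∈ opened S →
  (α * toℚ (L I) ≤ toℚ (load (assign S) i)) × (toℚ (load (assign S) i) ≤ β * toℚ (U I))

mkInstance : ∀ {m n} → (Point m n → Point m n → ℚ) → (Fin n → ℚ) → ℕ → ℕ → Instance m n
mkInstance c f Lb Ub = record
  { fcost = f ; scost = λ j i → c (client j) (facility i) ; L = Lb ; U = Ub }

-- The instance I₁: each client j relocated to σᵗ(j); facilities of Fᵗ free.
mkInstance₁ : ∀ {m n} → (Point m n → Point m n → ℚ) → (Fin n → ℚ) → ℕ → ℕ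
            → Sol m n → Instance m n
mkInstance₁ c f Lb Ub St = record
  { fcost = λ i → if lookup (opened St) i then 0ℚ else f i
  ; scost = λ j i → c (facility (assign St j)) (facility i)
  ; L = Lb ; U = Ub }

{-# OPTIONS --safe #-}
module Submission where

-- The optimum O of I is itself feasible for I₁, since both instances have the
-- same bounds, so it suffices to bound Cost_{I₁}(O). Opening O in I₁ costs at
-- most opening it in I because f ≥ 0, and serving j from σᴼ(j) in I₁ costs
-- c(σᵗ(j), σᴼ(j)) ≤ c(j, σᵗ(j)) + c(j, σᴼ(j)) by the triangle inequality;
-- the opening cost of Fᵗ in I is non-negative, so adding it keeps the bound.

open import Defs
open import Data.Nat using (ℕ)
open import Data.Fin using (Fin)
open import Data.Fin.Subset using (Subset)
open import Data.Rational using (ℚ; 0ℚ; 1ℚ; ½; _+_; _≤_; _<_)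
open import Data.Rational.Properties
  using (≤-refl; ≤-trans; ≤-reflexive; +-mono-≤; +-monoˡ-≤; +-identityˡ; +-0-commutativeMonoid; module ≤-Reasoning)
open import Data.Product using (∃; _,_)
open import Data.List using (List; []; _∷_; map; allFin)
open import Data.Bool using (true; false; if_then_else_)
open import Data.Vec using (lookup)
open import Relation.Binary.PropositionalEquality using (_≡_; sym; cong; module ≡-Reasoning)
open import Algebra.Bundles using (CommutativeMonoid)
open import Algebra.Properties.CommutativeSemigroup
  (CommutativeMonoid.commutativeSemigroup +-0-commutativeMonoid) using (interchange)

module _ {A : Set} where

  sumℚ-mono : (xs : List A) {f g : A → ℚ} → (∀ x → f x ≤ g x)
            → sumℚ (map f xs) ≤ sumℚ (map g xs)
  sumℚ-mono []       f≤g = ≤-refl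
  sumℚ-mono (x ∷ xs) f≤g = +-mono-≤ (f≤g x) (sumℚ-mono xs f≤g)

  sumℚ-nonneg : (xs : List A) {f : A → ℚ} → (∀ x → 0ℚ ≤ f x) → 0ℚ ≤ sumℚ (map f xs)
  sumℚ-nonneg []       f≥0 = ≤-refl
  sumℚ-nonneg (x ∷ xs) f≥0 = +-mono-≤ (f≥0 x) (sumℚ-nonneg xs f≥0)

  sumℚ-map-+ : (xs : List A) (f g : A → ℚ)
             → sumℚ (map (λ x → f x + g x) xs) ≡ sumℚ (map f xs) + sumℚ (map g xs)
  sumℚ-map-+ []       f g = sym (+-identityˡ 0ℚ)
  sumℚ-map-+ (x ∷ xs) f g = begin
    (f x + g x) + sumℚ (map (λ x → f x + g x) xs)
      ≡⟨ cong ((f x + g x) +_) (sumℚ-map-+ xs f g) ⟩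
    (f x + g x) + (sumℚ (map f xs) + sumℚ (map g xs))
      ≡⟨ interchange (f x) (g x) _ _ ⟩
    (f x + sumℚ (map f xs)) + (g x + sumℚ (map g xs)) ∎
    where open ≡-Reasoning

module _ {m n : ℕ} where

  openingCost : (Fin n → ℚ) → Subset n → ℚ
  openingCost f F = sumℚ (map (λ i → if lookup F i then f i else 0ℚ) (allFin n))

  serviceCost : (Fin m → Fin n → ℚ) → (Fin m → Fin n) → ℚ
  serviceCost s σ = sumℚ (map (λ j → s j (σ j)) (allFin m))

  openingCost-mono : {f g : Fin n → ℚ} → (∀ i → f i ≤ g i) → (F : Subset n)
                   → openingCost f F ≤ openingCost g F
  openingCost-mono f≤g F = sumℚ-mono (allFin n) λ i → if-mono (lookup F i) (f≤g i)
    where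
    if-mono : ∀ b {x y} → x ≤ y → (if b then x else 0ℚ) ≤ (if b then y else 0ℚ)
    if-mono true  x≤y = x≤y
    if-mono false x≤y = ≤-refl

  openingCost-nonneg : {f : Fin n → ℚ} → (∀ i → 0ℚ ≤ f i) → (F : Subset n)
                     → 0ℚ ≤ openingCost f F
  openingCost-nonneg {f} f≥0 F = sumℚ-nonneg (allFin n) λ i → if-nonneg (lookup F i) i
    where
    if-nonneg : ∀ b i → 0ℚ ≤ (if b then f i else 0ℚ)
    if-nonneg true  i = f≥0 i
    if-nonneg false i = ≤-refl

  openingCost-relocated≤ : {f : Fin n → ℚ} → (∀ i → 0ℚ ≤ f i) → (Fᵗ F : Subset n)
                         → openingCost (λ i → if lookup Fᵗ i then 0ℚ else f i) F
                           ≤ openingCost f Fᵗ + openingCost f F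
  openingCost-relocated≤ {f} f≥0 Fᵗ F = begin
    openingCost (λ i → if lookup Fᵗ i then 0ℚ else f i) F ≤⟨ openingCost-mono free≤f F ⟩
    openingCost f F                                      ≡⟨ sym (+-identityˡ _) ⟩
    0ℚ + openingCost f F                                 ≤⟨ +-monoˡ-≤ _ (openingCost-nonneg f≥0 Fᵗ) ⟩
    openingCost f Fᵗ + openingCost f F                   ∎
    where
    open ≤-Reasoning
    free≤f : ∀ i → (if lookup Fᵗ i then 0ℚ else f i) ≤ f i
    free≤f i with lookup Fᵗ i
    ... | true  = f≥0 i
    ... | false = ≤-refl

  module _ {c : Point m n → Point m n → ℚ} (metric : IsMetric c) where
    open IsMetric metric

    triangle-from : ∀ x y z → c y z ≤ c x y + c x z
    triangle-from x y z = ≤-trans (triangle y x z) (≤-reflexive (cong (_+ c x z) (symm y x)))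

    serviceCost-relocated≤ : (σᵗ σ : Fin m → Fin n)
      → serviceCost (λ j i → c (facility (σᵗ j)) (facility i)) σ
        ≤ serviceCost (λ j i → c (client j) (facility i)) σᵗ
          + serviceCost (λ j i → c (client j) (facility i)) σ
    serviceCost-relocated≤ σᵗ σ = begin
      sumℚ (map (λ j → c (facility (σᵗ j)) (facility (σ j))) (allFin m))
        ≤⟨ sumℚ-mono (allFin m) (λ j → triangle-from (client j) (facility (σᵗ j)) (facility (σ j))) ⟩
      sumℚ (map (λ j → c (client j) (facility (σᵗ j)) + c (client j) (facility (σ j))) (allFin m))
        ≡⟨ sumℚ-map-+ (allFin m) _ _ ⟩
      serviceCost (λ j i → c (client j) (facility i)) σᵗ
        + serviceCost (λ j i → c (client j) (facility i)) σ ∎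
      where open ≤-Reasoning

    Cost-relocated≤ : {f : Fin n → ℚ} → (∀ i → 0ℚ ≤ f i) → (Lb Ub : ℕ) → (St S : Sol m n)
      → Cost (mkInstance₁ c f Lb Ub St) S
        ≤ Cost (mkInstance c f Lb Ub) St + Cost (mkInstance c f Lb Ub) S
    Cost-relocated≤ {f} f≥0 Lb Ub St S =
      ≤-trans (+-mono-≤ (openingCost-relocated≤ f≥0 (opened St) (opened S))
                        (serviceCost-relocated≤ (assign St) (assign S)))
              (≤-reflexive (interchange (openingCost f (opened St)) (openingCost f (opened S))
                                        (serviceCost s (assign St)) (serviceCost s (assign S))))
      where
      s : Fin m → Fin n → ℚ
      s j i = c (client j) (facility i)

lemma3p1 : ∀ {m n : ℕ} (c : Point m n → Point m n → ℚ) → IsMetric c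
         → (f : Fin n → ℚ) → (∀ i → 0ℚ ≤ f i) → (Lb Ub : ℕ)
         → (∃ λ S → Feasible (mkInstance c f Lb Ub) S)
         → (O : Sol m n) → Optimal (mkInstance c f Lb Ub) O
         → (α : ℚ) → ½ < α → α ≤ 1ℚ
         → (St : Sol m n) → TriCriteria (mkInstance c f Lb Ub) α St
         → (O₁ : Sol m n) → Optimal (mkInstance₁ c f Lb Ub St) O₁
         → Cost (mkInstance₁ c f Lb Ub St) O₁
           ≤ Cost (mkInstance c f Lb Ub) St + Cost (mkInstance c f Lb Ub) O
lemma3p1 c metric f f≥0 Lb Ub _ O (O-feasible , _) α _ _ St _ O₁ (_ , O₁-optimal) =
  ≤-trans (O₁-optimal O O-feasible) (Cost-relocated≤ metric f≥0 Lb Ub St O)
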